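{- Let $T$ be a permutation tableau and let $P=p_1p_2\cdots p_r$ be an alternating path of $T$ (written as the sequence of labels of its dots), starting with a dot labeled $p_1$ and ending with a black dot labeled $p_r$. Then $p_1,p_2,\ldots,p_r$ appear in this left-to-right order in the permutation $\xi(T)$, i.e. $p_1p_2\cdots p_r$ is a subsequence of $\xi(T)$.
   Context: A permutation tableau of length $n$ is a Ferrers diagram (left-justified rows of weakly decreasing length from top to bottom; rows of length $0$ are allowed, and every column is nonempty) whose cells are filled with $0$'s and $1$'s such that (i) each column contains at least one $1$, and (ii) there is no $0$ that has a $1$ above it in its column and a $1$ to its left in its row. The boundary path of the diagram from the top-right corner to the bottom-left corner consists of $n$ unit steps, labeled $1,\ldots,n$ in order; a vertical step gives the row ending there its label, a horizontal step gives the column above it its label. $(i,j)$ denotes the cell in row labeled $i$ and column labeled $j$. A $0$ is restricted if there is a $1$ above it in its column. A row is unrestricted if it contains no restricted $0$ (e.g. empty rows). The topmost $1$ of each column is a black dot, labeled by its column label; in each row containing a restricted $0$, the rightmost restricted $0$ is a white dot, labeled by its row label. The alternating path starting at a dot $d$ is the sequence of dots $d=d_1,d_2,\ldots$ where: if $d_m$ is a white dot in column $j$, $d_{m+1}$ is the black dot of column $j$; if $d_m$ is a black dot in a row $i$ that is not unrestricted, $d_{m+1}$ is the white dot of row $i$; if $d_m$ is a black dot in an unrestricted row, the path ends. It is represented by the sequence of labels of its dots. The bijection $\xi$ (Corteel–Nadeau): start with the labels of the unrestricted rows in increasing order. Process the column labels $j$ in decreasing order: if the black dot of column $j$ is in cell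 $(i,j)$, insert $j$ immediately to the left of $i$; then, if column $j$ contains white dots in rows $i_1<\cdots<i_k$, insert $i_1,\ldots,i_k$ in increasing order immediately to the left of $j$. The final word is the permutation $\xi(T)$ of $[n]$. -}

module Defs where

open import Data.Nat using (ℕ)
open import Data.Bool using (Bool; true; false; _∧_; not; if_then_else_)
open import Data.Fin using (Fin; _<_; _≟_)
open import Data.Fin.Properties using (_<?_)
open import Data.List using (List; []; _∷_; _++_; [_]; head; filterᵇ; foldr)
open import Data.Bool.ListAction using (any)
open import Data.List.Base using (allFin)
open import Data.Maybe using (Maybe; just; nothing)
open import Data.Product using (_×_; ∃; ∃-syntax)
open import Data.Empty using (⊥)
open import Relation.Nullary using (¬_; yes; no)
open import Relation.Nullary.Decidable using (⌊_⌋)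
open import Relation.Binary.PropositionalEquality using (_≡_)

-- The n steps of the boundary path (top-right to bottom-left) are labelled
-- by Fin n (label k+1 of the paper is 'k : Fin n').  'vert k ≡ true' means
-- step k is vertical (k labels a row), 'vert k ≡ false' means horizontal
-- (k labels a column).  Row i consists of the columns j with i < j (those
-- horizontal steps occurring after i); so the cells are exactly the pairs
-- (i , j) with i a row, j a column, i < j.  Rows with larger labels lie
-- lower; columns with larger labels lie further to the left.
-- 'fill i j' is the entry of cell (i , j) (true = 1, false = 0); its value
-- outside cells is irrelevant.

record Tableau (n : ℕ) : Set where
  field
    vert : Fin n → Bool
    fill : Fin n → Fin n → Bool

open Tableau public

module _ {n : ℕ} (T : Tableau n) where

  IsRow : Fin n → Set
  IsRow i = vert T i ≡ true

  IsCol : Fin n → Set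
  IsCol j = vert T j ≡ false

  IsCell : Fin n → Fin n → Set
  IsCell i j = IsRow i × IsCol j × i < j

  OneAt : Fin n → Fin n → Set
  OneAt i j = IsCell i j × fill T i j ≡ true

  ZeroAt : Fin n → Fin n → Set
  ZeroAt i j = IsCell i j × fill T i j ≡ false

  IsPermTableau : Set
  IsPermTableau =
    (∀ j → IsCol j → ∃[ i ] OneAt i j) ×
    (∀ i j → ZeroAt i j →
       ¬ ((∃[ i' ] (i' < i × OneAt i' j)) × (∃[ j' ] (j < j' × OneAt i j'))))

  Restricted : Fin n → Fin n → Set
  Restricted i j = ZeroAt i j × ∃[ i' ] (i' < i × OneAt i' j)

  Unrestricted : Fin n → Set
  Unrestricted i = IsRow i × (∀ j → ¬ Restricted i j)

  IsBlack : Fin n → Fin n → Set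
  IsBlack i j = OneAt i j × (∀ i' → i' < i → ¬ OneAt i' j)

  IsWhite : Fin n → Fin n → Set
  IsWhite i j = Restricted i j × (∀ j' → j' < j → ¬ Restricted i j')

data Dot (n : ℕ) : Set where
  black : (i j : Fin n) → Dot n
  white : (i j : Fin n) → Dot n

label : ∀ {n} → Dot n → Fin n
label (black i j) = j
label (white i j) = i

module _ {n : ℕ} (T : Tableau n) where

  PathStep : Dot n → Dot n → Set
  PathStep (white i j) (black i' j') = IsWhite T i j × j' ≡ j × IsBlack T i' j'
  PathStep (black i j) (white i' j') = IsBlack T i j × i' ≡ i × IsWhite T i' j'
  PathStep (white _ _) (white _ _) = ⊥
  PathStep (black _ _) (black _ _) = ⊥

  PathEnd : Dot n → Set
  PathEnd (black i j) = IsBlack T i j × Unrestricted T i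
  PathEnd (white _ _) = ⊥

  data AltPath : List (Dot n) → Set where
    end  : ∀ {d} → PathEnd d → AltPath [ d ]
    step : ∀ {d d' ds} → PathStep d d' → AltPath (d' ∷ ds) → AltPath (d ∷ d' ∷ ds)

module _ {n : ℕ} (T : Tableau n) where

  ltB : Fin n → Fin n → Bool
  ltB i j = ⌊ i <? j ⌋

  cellB : Fin n → Fin n → Bool
  cellB i j = vert T i ∧ not (vert T j) ∧ ltB i j

  oneB : Fin n → Fin n → Bool
  oneB i j = cellB i j ∧ fill T i j

  restrB : Fin n → Fin n → Bool
  restrB i j = cellB i j ∧ not (fill T i j) ∧
               any (λ i' → ltB i' i ∧ oneB i' j) (allFin n)

  unrestrB : Fin n → Bool
  unrestrB i = vert T i ∧ not (any (restrB i) (allFin n))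

  blackRow : Fin n → Maybe (Fin n)
  blackRow j = head (filterᵇ (λ i → oneB i j) (allFin n))

  -- column of the white dot of row i (rightmost = smallest-labelled
  -- restricted 0)
  whiteCol : Fin n → Maybe (Fin n)
  whiteCol i = head (filterᵇ (restrB i) (allFin n))

  whiteIn : Fin n → Fin n → Bool
  whiteIn j i with whiteCol i
  ... | nothing = false
  ... | just j' = ⌊ j' ≟ j ⌋

  whitesOf : Fin n → List (Fin n)
  whitesOf j = filterᵇ (whiteIn j) (allFin n)

insertBefore : ∀ {n} → Fin n → List (Fin n) → List (Fin n) → List (Fin n)
insertBefore x ys [] = []
insertBefore x ys (z ∷ w) with ⌊ x ≟ z ⌋
... | true  = ys ++ z ∷ w
... | false = z ∷ insertBefore x ys w

module _ {n : ℕ} (T : Tableau n) where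

  processCol : Fin n → List (Fin n) → List (Fin n)
  processCol j w with blackRow T j
  ... | nothing = w
  ... | just i  = insertBefore j (whitesOf T j) (insertBefore i [ j ] w)

  -- start: unrestricted rows in increasing order; then process the column
  -- labels in decreasing order (foldr over 0,1,…,n-1 processes n-1 first).
  ξ : List (Fin n)
  ξ = foldr (λ j w → if vert T j then w else processCol j w)
            (filterᵇ (unrestrB T) (allFin n))
            (allFin n)

-- ξ T is built from the unrestricted rows by insertions only, and inserting
-- letters never destroys a subword.  Processing column c puts c immediately
-- before the row i of its black dot and the rows of its white dots
-- immediately before c.  On the path, a black dot (i, j) is followed by the
-- white dot (i, c) of its row, and j < c because a permutation tableau has
-- no 0 with a 1 above it and a 1 to its left; so column c is processed
-- before column j.  Hence, by induction along the path, when column j is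
-- processed its row i already precedes the rest of the path, and j lands
-- right before i.
module Submission where

open import Defs
open import Data.List using (List; map; []; _∷_; _++_; [_]; head; drop; foldr; filterᵇ; tabulate; allFin)
open import Data.List.Relation.Binary.Sublist.Propositional
  using (_⊆_; []; _∷_; _∷ʳ_; minimum; ⊆-refl; ⊆-trans; from∈)

open import Data.Bool using (Bool; true; false; _∧_; if_then_else_) renaming (T to IsTrue)
open import Data.Bool.Properties using (T-≡; T-not-≡; T-∧; ¬-not)
open import Data.Bool.ListAction using (any)
open import Data.Empty using (⊥; ⊥-elim)
open import Data.Fin using (Fin; zero; suc; toℕ; _<_; _≟_)
open import Data.Fin.Properties using (<-cmp)
open import Data.List.Properties using (drop-drop)
open import Data.List.Membership.Propositional using (_∈_; lose; find)
open import Data.List.Membership.Propositional.Properties using (∈-allFin; ∈-filter⁺)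
open import Data.List.Relation.Binary.Sublist.Propositional.Properties using (++⁺; ++⁺ˡ)
open import Data.List.Relation.Unary.Any using (Any)
open import Data.List.Relation.Unary.Any.Properties using (any⁺; any⁻)
open import Data.Maybe using (just; nothing)
open import Data.Nat using (ℕ; _≤_; _∸_; z<s; s<s) renaming (suc to 1+)
open import Data.Nat.Properties using (m+[n∸m]≡n)
open import Data.Product using (_,_)
open import Function using (_∘_)
open import Function.Bundles using (Equivalence)
open import Relation.Binary.Definitions using (tri<; tri≈; tri>)
open import Relation.Binary.PropositionalEquality using (_≡_; refl; sym; trans; cong; subst)
open import Relation.Nullary using (¬_; yes; no)
open import Relation.Nullary.Decidable using (T?; toWitness; fromWitness)

open Equivalence using (to; from)

module _ {n : ℕ} where

  ⊆-insertBefore : ∀ (x : Fin n) ys w → w ⊆ insertBefore x ys w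
  ⊆-insertBefore x ys [] = []
  ⊆-insertBefore x ys (z ∷ w) with x ≟ z
  ... | yes _ = ++⁺ˡ ys ⊆-refl
  ... | no _  = refl ∷ ⊆-insertBefore x ys w

  -- Insertion happens before the first occurrence of x, which is no later
  -- than the occurrence that an embedding of x ∷ v uses.
  ++⊆-insertBefore : ∀ {x : Fin n} {v w} ys → x ∷ v ⊆ w → ys ++ x ∷ v ⊆ insertBefore x ys w
  ++⊆-insertBefore {x} ys (z ∷ʳ xv⊆w) with x ≟ z
  ... | yes refl = ++⁺ ⊆-refl (z ∷ʳ xv⊆w)
  ... | no _     = z ∷ʳ ++⊆-insertBefore ys xv⊆w
  ++⊆-insertBefore {x} ys (refl ∷ v⊆w) with x ≟ x
  ... | yes _   = ++⁺ ⊆-refl (refl ∷ v⊆w)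
  ... | no x≢x = ⊥-elim (x≢x refl)

module _ {A B : Set} (f : A → List B → List B) (inflationary : ∀ x w → w ⊆ f x w) (e : List B) where

  ⊆-foldr : ∀ xs → e ⊆ foldr f e xs
  ⊆-foldr []       = ⊆-refl
  ⊆-foldr (x ∷ xs) = ⊆-trans (⊆-foldr xs) (inflationary x _)

  foldr-drop-⊆ : ∀ d xs → foldr f e (drop d xs) ⊆ foldr f e xs
  foldr-drop-⊆ 0      xs       = ⊆-refl
  foldr-drop-⊆ (1+ d) []       = ⊆-refl
  foldr-drop-⊆ (1+ d) (x ∷ xs) = ⊆-trans (foldr-drop-⊆ d xs) (inflationary x _)

module _ {A : Set} where

  drop-tabulate : ∀ {k} (f : Fin k → A) i → drop (toℕ i) (tabulate f) ≡ f i ∷ drop (1+ (toℕ i)) (tabulate f)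
  drop-tabulate f zero    = refl
  drop-tabulate f (suc i) = drop-tabulate (f ∘ suc) i

  head-filterᵇ-tabulate : ∀ {k} (f : Fin k → A) (p : A → Bool) i → IsTrue (p (f i)) →
                          (∀ i′ → i′ < i → ¬ IsTrue (p (f i′))) →
                          head (filterᵇ p (tabulate f)) ≡ just (f i)
  head-filterᵇ-tabulate f p zero pfi _ with p (f zero)
  ... | true = refl
  head-filterᵇ-tabulate f p (suc i) pfi earlier with p (f zero) | earlier zero z<s
  ... | true  | ¬p0 = ⊥-elim (¬p0 _)
  ... | false | _   = head-filterᵇ-tabulate (f ∘ suc) p i pfi (λ i′ i′<i → earlier (suc i′) (s<s i′<i))

module _ {n : ℕ} (T : Tableau n) where

  cellB⁺ : ∀ {i j} → IsCell T i j → IsTrue (cellB T i j)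
  cellB⁺ (vi , vj , i<j) = from T-∧ (from T-≡ vi , from T-∧ (from T-not-≡ vj , fromWitness i<j))

  cellB⁻ : ∀ {i j} → IsTrue (cellB T i j) → IsCell T i j
  cellB⁻ h = let (vi , h′) = to T-∧ h ; (vj , i<j) = to T-∧ h′ in
    to T-≡ vi , to T-not-≡ vj , toWitness i<j

  oneB⁺ : ∀ {i j} → OneAt T i j → IsTrue (oneB T i j)
  oneB⁺ (c , f) = from T-∧ (cellB⁺ c , from T-≡ f)

  oneB⁻ : ∀ {i j} → IsTrue (oneB T i j) → OneAt T i j
  oneB⁻ h = let (c , f) = to T-∧ h in cellB⁻ c , to T-≡ f

  restrB⁺ : ∀ {i j} → Restricted T i j → IsTrue (restrB T i j)
  restrB⁺ {i} {j} ((c , f) , i′ , i′<i , one) =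
    from T-∧ (cellB⁺ c , from T-∧ (from T-not-≡ f , any⁺ oneAboveB oneAbove))
    where
      oneAboveB : Fin n → Bool
      oneAboveB i″ = ltB T i″ i ∧ oneB T i″ j
      oneAbove : Any (IsTrue ∘ oneAboveB) (allFin n)
      oneAbove = lose (∈-allFin i′) (from (T-∧ {ltB T i′ i}) (fromWitness i′<i , oneB⁺ one))

  restrB⁻ : ∀ {i j} → IsTrue (restrB T i j) → Restricted T i j
  restrB⁻ {i} {j} h
    with (c , h′) ← to T-∧ h
    with (f , above) ← to T-∧ h′
    with (i′ , _ , h″) ← find (any⁻ (λ i″ → ltB T i″ i ∧ oneB T i″ j) (allFin n) above)
    with (i′<i , one) ← to (T-∧ {ltB T i′ i}) h″
    = (cellB⁻ c , to T-not-≡ f) , i′ , toWitness i′<i , oneB⁻ one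

  blackRow-black : ∀ {i j} → IsBlack T i j → blackRow T j ≡ just i
  blackRow-black {i} {j} (one , topmost) =
    head-filterᵇ-tabulate (λ x → x) (λ x → oneB T x j) i (oneB⁺ one)
      (λ i′ i′<i → topmost i′ i′<i ∘ oneB⁻)

  whiteCol-white : ∀ {i j} → IsWhite T i j → whiteCol T i ≡ just j
  whiteCol-white {i} {j} (restricted , rightmost) =
    head-filterᵇ-tabulate (λ x → x) (restrB T i) j (restrB⁺ restricted)
      (λ j′ j′<j → rightmost j′ j′<j ∘ restrB⁻)

  ∈-whitesOf : ∀ {i j} → IsWhite T i j → i ∈ whitesOf T j
  ∈-whitesOf {i} {j} w = ∈-filter⁺ (T? ∘ whiteIn T j) (∈-allFin i) (whiteIn-white (whiteCol-white w))
    where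
      whiteIn-white : whiteCol T i ≡ just j → IsTrue (whiteIn T j i)
      whiteIn-white eq rewrite eq = fromWitness refl

  ∈-unrestricted : ∀ {i} → Unrestricted T i → i ∈ filterᵇ (unrestrB T) (allFin n)
  ∈-unrestricted {i} (vi , noRestricted) =
    ∈-filter⁺ (T? ∘ unrestrB T) (∈-allFin i) (from T-∧ (from T-≡ vi , from T-not-≡ (¬-not noRestrictedB)))
    where
      noRestrictedB : any (restrB T i) (allFin n) ≡ true → ⊥
      noRestrictedB any≡true with (j , _ , h) ← find (any⁻ (restrB T i) (allFin n) (from T-≡ any≡true))
        = noRestricted j (restrB⁻ h)

  black-left-of-white : IsPermTableau T → ∀ {i j c} → IsBlack T i j → IsWhite T i c → j < c
  black-left-of-white (_ , noZeroBetween) {i} {j} {c} (one@(_ , fij) , _) (((cellic , fic) , above) , _)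
    with <-cmp j c
  ... | tri< j<c _ _ = j<c
  ... | tri> _ _ c<j = ⊥-elim (noZeroBetween i c (cellic , fic) (above , j , c<j , one))
  ... | tri≈ _ refl _ with () ← trans (sym fij) fic

  processStep : Fin n → List (Fin n) → List (Fin n)
  processStep j w = if vert T j then w else processCol T j w

  processed : ℕ → List (Fin n)
  processed k = foldr processStep (filterᵇ (unrestrB T) (allFin n)) (drop k (allFin n))

  ⊆-processCol : ∀ j w → w ⊆ processCol T j w
  ⊆-processCol j w with blackRow T j
  ... | just i  = ⊆-trans (⊆-insertBefore i [ j ] w) (⊆-insertBefore j (whitesOf T j) _)
  ... | nothing = ⊆-refl

  ⊆-processStep : ∀ j w → w ⊆ processStep j w
  ⊆-processStep j w = ⊆-if (vert T j)
    where
      ⊆-if : ∀ b → w ⊆ (if b then w else processCol T j w)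
      ⊆-if true  = ⊆-refl
      ⊆-if false = ⊆-processCol j w

  unrestricted-⊆-processed : ∀ k → filterᵇ (unrestrB T) (allFin n) ⊆ processed k
  unrestricted-⊆-processed k = ⊆-foldr processStep ⊆-processStep _ (drop k (allFin n))

  processed-antitone : ∀ {k m} → k ≤ m → processed m ⊆ processed k
  processed-antitone {k} {m} k≤m = subst (λ m′ → processed m′ ⊆ processed k) (m+[n∸m]≡n k≤m)
    (subst (λ ws → foldr processStep _ ws ⊆ processed k) (drop-drop k (m ∸ k) (allFin n))
      (foldr-drop-⊆ processStep ⊆-processStep _ (m ∸ k) (drop k (allFin n))))

  processed-⊆-ξ : ∀ k → processed k ⊆ ξ T
  processed-⊆-ξ k = foldr-drop-⊆ processStep ⊆-processStep _ k (allFin n)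

  processStep-black : ∀ {i c w} → IsBlack T i c →
                      processStep c w ≡ insertBefore c (whitesOf T c) (insertBefore i [ c ] w)
  processStep-black {i} {c} {w} isBlack@(((_ , isCol , _) , _) , _) =
    trans (cong (λ b → if b then w else processCol T c w) isCol) (processCol-just (blackRow-black isBlack))
    where
      processCol-just : blackRow T c ≡ just i →
                        processCol T c w ≡ insertBefore c (whitesOf T c) (insertBefore i [ c ] w)
      processCol-just eq with blackRow T c
      processCol-just refl | just _ = refl

  processed-column : ∀ {i c v} → IsBlack T i c → i ∷ v ⊆ processed (1+ (toℕ c)) →
                     whitesOf T c ++ c ∷ i ∷ v ⊆ processed (toℕ c)
  processed-column {i} {c} isBlack iv⊆w
    rewrite drop-tabulate (λ x → x) c | processStep-black {w = processed (1+ (toℕ c))} isBlack =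
    ++⊆-insertBefore (whitesOf T c) (++⊆-insertBefore [ c ] iv⊆w)

module _ {n : ℕ} {T : Tableau n} (PT : IsPermTableau T) where

  isBlack-head : ∀ {i j ds} → AltPath T (black i j ∷ ds) → IsBlack T i j
  isBlack-head (end (isBlack , _))                    = isBlack
  isBlack-head (step {d' = white _ _} (isBlack , _) _) = isBlack

  -- After a black dot in row i the path ends or continues at the white dot
  -- of row i, whose label is i.
  labels-after-black : ∀ {i j ds} → AltPath T (black i j ∷ ds) → map label ds ⊆ i ∷ map label (drop 1 ds)
  labels-after-black (end _)                              = minimum _
  labels-after-black (step {d' = white _ _} (_ , refl , _) _) = ⊆-refl

  white-path : ∀ {r c ds} → AltPath T (white r c ∷ ds) → r ∷ map label ds ⊆ processed T (toℕ c)
  row-path : ∀ {i j ds} → AltPath T (black i j ∷ ds) →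
             i ∷ map label (drop 1 ds) ⊆ processed T (1+ (toℕ j))

  white-path (step {d' = black _ _} (isWhite , refl , isBlack) path) =
    ⊆-trans (++⁺ (from∈ (∈-whitesOf T isWhite)) (refl ∷ labels-after-black path))
            (processed-column T isBlack (row-path path))

  row-path (end (_ , unrestricted)) =
    ⊆-trans (from∈ (∈-unrestricted T unrestricted)) (unrestricted-⊆-processed T (1+ (toℕ _)))
  row-path (step {d' = white _ _} (isBlack , refl , isWhite) path) =
    ⊆-trans (white-path path) (processed-antitone T (black-left-of-white T PT isBlack isWhite))

  black-path : ∀ {i j ds} → AltPath T (black i j ∷ ds) → j ∷ map label ds ⊆ processed T (toℕ j)
  black-path path =
    ⊆-trans (refl ∷ labels-after-black path)
            (⊆-trans (++⁺ˡ (whitesOf T _) ⊆-refl) (processed-column T (isBlack-head path) (row-path path)))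

lemma2p4 : ∀ {n} (T : Tableau n) → IsPermTableau T →
    (ds : List (Dot n)) → AltPath T ds → map label ds ⊆ ξ T
lemma2p4 T PT (black i j ∷ ds) path = ⊆-trans (black-path PT path) (processed-⊆-ξ T (toℕ j))
lemma2p4 T PT (white r c ∷ ds) path = ⊆-trans (white-path PT path) (processed-⊆-ξ T (toℕ c))
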